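{- Let $p$ be a prime, let $A$ be a matrix over $GF(p)$ whose columns are labelled by a finite set $E$, let $M=M[A]$, let $a,b\in E$ be distinct, $\alpha\in GF(p)\setminus\{0\}$, and let $M_{a,b}$ be the splitting matroid. Then the set of circuits of $M_{a,b}$ is $\mathcal{C}(M_{a,b})=\mathcal{C}_0\cup\mathcal{C}_1\cup\mathcal{C}_2$, where $\mathcal{C}_0=\{C\in\mathcal{C}(M): C \text{ is a } p\text{ -circuit or } C\cap\{a,b\}=\emptyset\}$; $\mathcal{C}_1$ is the set of minimal members (under inclusion) of the family of sets $C\cup I$ that are $p$-dependent and such that there are no two disjoint $np$-circuits $C_1',C_2'$ of $M$ with $C_1'\cup C_2'\subseteq C\cup I$; $\mathcal{C}_2$ is the set of minimal members of the family $\{C_1\cup C_2: C_1,C_2\in\mathcal{C}(M),\ a\in C_1,\ b\in C_2,\ C_1\cap C_2=\emptyset,\ \text{and there is no } C\in\mathcal{C}_0\cup\mathcal{C}_1 \text{ with } C\subset C_1\cup C_2\}$.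
   Context: $\mathcal{C}(M)$ denotes the set of circuits of $M$. The splitting matroid $M_{a,b}$ is $M[A_{a,b}]$, where $A_{a,b}$ is $A$ with one extra row appended having entries $\alpha$ in columns $a,b$ and $0$ elsewhere. For a circuit $C$ of $M$, the columns $u\in C$ satisfy a relation $\sum_{u\in C}c_u u=0$ over $GF(p)$ with all $c_u\ne0$, unique up to nonzero scalar. $C$ is a $p$-circuit if $a,b\in C$ and $c_a+c_b=0$; $C$ is an $np$-circuit if $|C\cap\{a,b\}|=1$, or $a,b\in C$ and $c_a+c_b\neq0$. A set of the form $C\cup I$, where $C$ is an $np$-circuit of $M$, $I$ is an independent set of $M$ with $C\cap I=\emptyset$, and $\{a,b\}\subseteq C\cup I$, is called $p$-dependent if it contains no member of $\mathcal{C}_0$ and there exist nonzero scalars $\beta_x\in GF(p)$ ($x\in C\cup I$) with $\sum_{x\in C\cup I}\beta_x x=0$ (as columns of $A$) and $\beta_a+\beta_b=0$. -}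

module Defs where

open import Data.Nat using (ℕ; zero; suc; _+_; _*_; NonZero)
open import Data.Nat.Divisibility using (_∣_)
open import Data.Fin using (Fin; toℕ) renaming (zero to fzero; suc to fsuc)
open import Data.Fin.Subset using (Subset; _∈_; _∉_; _⊆_; _⊂_; _∪_; _∩_; Empty)
open import Data.Vec using (tabulate; sum)
open import Data.Product using (Σ; ∃; _×_; _,_)
open import Data.Sum using (_⊎_)
open import Relation.Nullary using (¬_)
open import Relation.Binary.PropositionalEquality using (_≡_; _≢_)
open import Data.Fin using (_≟_)
open import Relation.Nullary using (yes; no)

-- Elements of GF(p) are represented by Fin p (residues 0 .. p-1).
-- A matrix over GF(p) with m rows and columns labelled by E = Fin n.
Matrix : ℕ → ℕ → ℕ → Set
Matrix p m n = Fin m → Fin n → Fin p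

Σℕ : ∀ {n} → (Fin n → ℕ) → ℕ
Σℕ f = sum (tabulate f)

IsRelation : ∀ {p m n} → Matrix p m n → (Fin n → Fin p) → Set
IsRelation {p} A β = ∀ i → p ∣ Σℕ (λ j → toℕ (β j) * toℕ (A i j))

SupportIs : ∀ {p n} → (Fin n → Fin p) → Subset n → Set
SupportIs {n = n} β X = ∀ (j : Fin n) → (toℕ (β j) ≢ 0 → j ∈ X) × (j ∈ X → toℕ (β j) ≢ 0)

Dependent : ∀ {p m n} → Matrix p m n → Subset n → Set
Dependent {p} {m} {n} A X =
  Σ (Fin n → Fin p) λ β → IsRelation A β
    × (∀ j → toℕ (β j) ≢ 0 → j ∈ X) × (∃ λ j → toℕ (β j) ≢ 0)

Independent : ∀ {p m n} → Matrix p m n → Subset n → Set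
Independent A X = ¬ Dependent A X

Circuit : ∀ {p m n} → Matrix p m n → Subset n → Set
Circuit A C = Dependent A C × (∀ D → D ⊂ C → Independent A D)

Disjoint : ∀ {n} → Subset n → Subset n → Set
Disjoint X Y = Empty (X ∩ Y)

appendRow : ∀ {R : Set} m → (Fin m → R) → R → Fin (suc m) → R
appendRow zero    f r fzero    = r
appendRow (suc m) f r fzero    = f fzero
appendRow (suc m) f r (fsuc i) = appendRow m (λ k → f (fsuc k)) r i

splitRow : ∀ {p n} .{{_ : NonZero p}} → Fin n → Fin n → Fin p → Fin n → Fin p
splitRow {p} a b α j with j ≟ a | j ≟ b
... | yes _ | _     = α
... | no _  | yes _ = α
... | no _  | no _  = Data.Nat.DivMod._mod_ 0 p
  where import Data.Nat.DivMod

splitMatrix : ∀ {p m n} .{{_ : NonZero p}} → Matrix p m n → Fin n → Fin n → Fin p → Matrix p (suc m) n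
splitMatrix {m = m} A a b α = appendRow m A (splitRow a b α)

module Splitting {p m n : ℕ} (A : Matrix p m n) (a b : Fin n) where

  -- p-circuit: a, b ∈ C and c_a + c_b = 0 for the (unique up to scalar) relation of C.
  PCircuit : Subset n → Set
  PCircuit C = Circuit A C × a ∈ C × b ∈ C
    × Σ (Fin n → Fin p) λ c → IsRelation A c × SupportIs c C × p ∣ (toℕ (c a) + toℕ (c b))

  NPCircuit : Subset n → Set
  NPCircuit C = Circuit A C ×
    (((a ∈ C × b ∉ C) ⊎ (a ∉ C × b ∈ C))
     ⊎ (a ∈ C × b ∈ C × Σ (Fin n → Fin p) λ c → IsRelation A c × SupportIs c C
                                               × ¬ (p ∣ (toℕ (c a) + toℕ (c b)))))

  InC0 : Subset n → Set
  InC0 C = Circuit A C × (PCircuit C ⊎ (a ∉ C × b ∉ C))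

  PDependent : Subset n → Set
  PDependent S =
    (Σ (Subset n) λ C → Σ (Subset n) λ I →
        NPCircuit C × Independent A I × Disjoint C I × S ≡ C ∪ I)
    × a ∈ S × b ∈ S
    × (∀ D → D ⊆ S → ¬ InC0 D)
    × (Σ (Fin n → Fin p) λ β → IsRelation A β × SupportIs β S × p ∣ (toℕ (β a) + toℕ (β b)))

  Family1 : Subset n → Set
  Family1 S = PDependent S
    × ¬ (Σ (Subset n) λ C₁ → Σ (Subset n) λ C₂ →
           NPCircuit C₁ × NPCircuit C₂ × Disjoint C₁ C₂ × (C₁ ∪ C₂) ⊆ S)

  InC1 : Subset n → Set
  InC1 S = Family1 S × (∀ T → Family1 T → ¬ (T ⊂ S))

  Family2 : Subset n → Set
  Family2 S =
    (Σ (Subset n) λ C₁ → Σ (Subset n) λ C₂ →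
       Circuit A C₁ × Circuit A C₂ × a ∈ C₁ × b ∈ C₂ × Disjoint C₁ C₂ × S ≡ C₁ ∪ C₂)
    × ¬ (Σ (Subset n) λ C → (InC0 C ⊎ InC1 C) × C ⊂ S)

  InC2 : Subset n → Set
  InC2 S = Family2 S × (∀ T → Family2 T → ¬ (T ⊂ S))

-- Because α ≠ 0 and p is prime, a vector β is a relation of A_{a,b} exactly when it is a
-- relation of A with β_a + β_b = 0.  So a circuit X of M_{a,b} is dependent in M and contains
-- a circuit C of M, and no proper subset of X lies in 𝒞₀.  If C = X, then X ∈ 𝒞₀.  If X
-- contains disjoint circuits C₁ ∋ a and C₂ ∋ b of M, a suitable combination of their relations
-- cancels on the extra row, so C₁ ∪ C₂ is dependent in M_{a,b} and equals X: X ∈ 𝒞₂.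
-- Otherwise C is an np-circuit, X ∖ C contains no circuit, and X ∈ 𝒞₁.  Conversely every member
-- of 𝒞₀ ∪ 𝒞₁ ∪ 𝒞₂ is dependent in M_{a,b}, and classifying a smaller circuit of M_{a,b} inside
-- it by the above contradicts the minimality and exclusion clauses defining 𝒞₀, 𝒞₁ and 𝒞₂.
{-# OPTIONS --safe #-}
module Submission where

open import Defs
open import Data.Empty using (⊥-elim)
open import Data.Fin using (Fin; zero; suc; toℕ; _≟_)
open import Data.Fin.Properties using (all?; any?; suc-injective; toℕ<n; toℕ-fromℕ<)
open import Data.Fin.Subset
  using (Subset; _∈_; _∉_; _⊆_; _⊂_; _∪_; _∩_; _-_; ∁; Nonempty)
open import Data.Fin.Subset.Induction using (⊂-wellFounded)
open import Data.Fin.Subset.Properties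
  using ( _∈?_; _⊆?_; _⊂?_; anySubset?; nonempty?; ⊆-refl; ⊆-trans; ⊆-antisym; p⊂q⇒p⊆q
        ; ⊆-⊂-trans; p⊆p∪q; q⊆p∪q; x∈p∪q⁺; x∈p∪q⁻; p∩q⊆p; p∩q⊆q; x∈p∩q⁺; x∈p∩q⁻
        ; x∈∁p⇒x∉p; x∉p⇒x∈∁p; x∈p⇒p-x⊂p; x∈p∧x≢y⇒x∈p-y)
open import Data.Nat as ℕ using (ℕ; zero; suc; _+_; _*_; _∸_; _%_; NonZero)
open import Data.Nat.DivMod
  using (_mod_; m%n<n; m<n⇒m%n≡m; m*n%n≡0; m%n%n≡m%n; %-distribˡ-+; %-distribˡ-*)
open import Data.Nat.Divisibility
  using (_∣_; _∣?_; _∣0; m%n≡0⇒n∣m; n∣m⇒m%n≡0; ∣m∣n⇒∣m+n; ∣n⇒∣m*n; ∣m⇒∣m*n; n∣m*n)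
open import Data.Nat.Primality using (Prime; euclidsLemma)
open import Data.Nat.Properties
  using (+-comm; +-identityʳ; *-comm; *-zeroʳ; *-assoc; *-distribˡ-+; *-distribʳ-+; <⇒≤; m+[n∸m]≡n
        ; +-commutativeSemigroup)
open import Algebra.Properties.CommutativeSemigroup +-commutativeSemigroup using (interchange)
open import Data.Product using (Σ; ∃; _×_; _,_; proj₁; proj₂)
open import Data.Sum using (_⊎_; inj₁; inj₂; [_,_])
open import Data.Vec.Functional using (_∷_; head; tail)
open import Function using (_∘_; id; _⇔_; mk⇔; Equivalence)
open import Induction.WellFounded using (Acc; acc)
open import Relation.Binary.PropositionalEquality
  using (_≡_; _≢_; _≗_; refl; sym; trans; cong; cong₂; subst; module ≡-Reasoning)
open import Relation.Nullary using (¬_; Dec; yes; no)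
open import Relation.Nullary.Decidable using (_×-dec_; _→-dec_; ¬?; map′; decidable-stable)

open ≡-Reasoning

Σℕ-cong : ∀ {n} {f g : Fin n → ℕ} → f ≗ g → Σℕ f ≡ Σℕ g
Σℕ-cong {zero}  f≗g = refl
Σℕ-cong {suc n} f≗g = cong₂ _+_ (f≗g zero) (Σℕ-cong (f≗g ∘ suc))

Σℕ-+ : ∀ {n} (f g : Fin n → ℕ) → Σℕ (λ j → f j + g j) ≡ Σℕ f + Σℕ g
Σℕ-+ {zero}  f g = refl
Σℕ-+ {suc n} f g = trans (cong (f zero + g zero +_) (Σℕ-+ (f ∘ suc) (g ∘ suc)))
                         (interchange (f zero) (g zero) (Σℕ (f ∘ suc)) (Σℕ (g ∘ suc)))

Σℕ-*ˡ : ∀ {n} k (f : Fin n → ℕ) → Σℕ (λ j → k * f j) ≡ k * Σℕ f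
Σℕ-*ˡ {zero}  k f = sym (*-zeroʳ k)
Σℕ-*ˡ {suc n} k f = trans (cong (k * f zero +_) (Σℕ-*ˡ k (f ∘ suc)))
                          (sym (*-distribˡ-+ k (f zero) (Σℕ (f ∘ suc))))

Σℕ-zero : ∀ {n} (f : Fin n → ℕ) → (∀ j → f j ≡ 0) → Σℕ f ≡ 0
Σℕ-zero {zero}  f f≡0 = refl
Σℕ-zero {suc n} f f≡0 = cong₂ _+_ (f≡0 zero) (Σℕ-zero (f ∘ suc) (f≡0 ∘ suc))

Σℕ-single : ∀ {n} (f : Fin n → ℕ) a → (∀ j → j ≢ a → f j ≡ 0) → Σℕ f ≡ f a
Σℕ-single f zero    f≡0 =
  trans (cong (f zero +_) (Σℕ-zero (f ∘ suc) (λ j → f≡0 (suc j) λ ()))) (+-identityʳ (f zero))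
Σℕ-single f (suc a) f≡0 =
  cong₂ _+_ (f≡0 zero λ ()) (Σℕ-single (f ∘ suc) a λ j j≢a → f≡0 (suc j) (j≢a ∘ suc-injective))

Σℕ-pair : ∀ {n} (f : Fin n → ℕ) {a b} → a ≢ b → (∀ j → j ≢ a → j ≢ b → f j ≡ 0) → Σℕ f ≡ f a + f b
Σℕ-pair f {zero}  {zero}  a≢b f≡0 = ⊥-elim (a≢b refl)
Σℕ-pair f {zero}  {suc b} a≢b f≡0 =
  cong (f zero +_) (Σℕ-single (f ∘ suc) b λ j j≢b → f≡0 (suc j) (λ ()) (j≢b ∘ suc-injective))
Σℕ-pair f {suc a} {zero}  a≢b f≡0 =
  trans (cong (f zero +_) (Σℕ-single (f ∘ suc) a λ j j≢a → f≡0 (suc j) (j≢a ∘ suc-injective) (λ ())))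
        (+-comm (f zero) (f (suc a)))
Σℕ-pair f {suc a} {suc b} a≢b f≡0 =
  cong₂ _+_ (f≡0 zero (λ ()) (λ ()))
            (Σℕ-pair (f ∘ suc) (a≢b ∘ cong suc) λ j j≢a j≢b →
               f≡0 (suc j) (j≢a ∘ suc-injective) (j≢b ∘ suc-injective))

Σℕ-%-cong : ∀ {n} d .{{_ : NonZero d}} {f g : Fin n → ℕ} →
            (∀ j → f j % d ≡ g j % d) → Σℕ f % d ≡ Σℕ g % d
Σℕ-%-cong {zero}  d f≡g = refl
Σℕ-%-cong {suc n} d {f} {g} f≡g = begin
  (f zero + Σℕ (f ∘ suc)) % d             ≡⟨ %-distribˡ-+ (f zero) _ d ⟩
  (f zero % d + Σℕ (f ∘ suc) % d) % d     ≡⟨ cong₂ (λ x y → (x + y) % d) (f≡g zero) (Σℕ-%-cong d (f≡g ∘ suc)) ⟩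
  (g zero % d + Σℕ (g ∘ suc) % d) % d     ≡⟨ %-distribˡ-+ (g zero) _ d ⟨
  (g zero + Σℕ (g ∘ suc)) % d             ∎

-- Exhaustive search; without function extensionality P has to respect ≗.
anyFunction? : ∀ {k n} {P : (Fin n → Fin k) → Set} →
               (∀ {f g} → f ≗ g → P f → P g) → (∀ f → Dec (P f)) → Dec (∃ P)
anyFunction? {n = zero}  resp P? =
  map′ (λ Pf → _ , Pf) (λ (f , Pf) → resp (λ ()) Pf) (P? (λ ()))
anyFunction? {n = suc n} resp P? =
  map′ (λ (x , g , Pxg) → x ∷ g , Pxg)
       (λ (f , Pf) → head f , tail f , resp (λ { zero → refl ; (suc j) → refl }) Pf)
       (any? λ x → anyFunction? (λ f≗g → resp λ { zero → refl ; (suc j) → f≗g j }) (P? ∘ (x ∷_)))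

∀-appendRow⁺ : ∀ {R : Set} {P : R → Set} m (f : Fin m → R) r →
               (∀ i → P (f i)) × P r → ∀ i → P (appendRow m f r i)
∀-appendRow⁺ zero    f r (Pf , Pr) zero    = Pr
∀-appendRow⁺ (suc m) f r (Pf , Pr) zero    = Pf zero
∀-appendRow⁺ (suc m) f r (Pf , Pr) (suc i) = ∀-appendRow⁺ m (f ∘ suc) r (Pf ∘ suc , Pr) i

∀-appendRow⁻ : ∀ {R : Set} {P : R → Set} m (f : Fin m → R) r →
               (∀ i → P (appendRow m f r i)) → (∀ i → P (f i)) × P r
∀-appendRow⁻ zero    f r P∷ = (λ ()) , P∷ zero
∀-appendRow⁻ (suc m) f r P∷ =
  let (Pf , Pr) = ∀-appendRow⁻ m (f ∘ suc) r (P∷ ∘ suc)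
  in (λ { zero → P∷ zero ; (suc i) → Pf i }) , Pr

⊆⇒≡⊎⊂ : ∀ {n} {D X : Subset n} → D ⊆ X → D ≡ X ⊎ D ⊂ X
⊆⇒≡⊎⊂ {D = D} {X} D⊆X with D ⊂? X
... | yes D⊂X = inj₂ D⊂X
... | no  D⊄X = inj₁ (⊆-antisym D⊆X λ {x} x∈X →
                  decidable-stable (x ∈? D) λ x∉D → D⊄X (D⊆X , x , x∈X , x∉D))

∪-⊆ : ∀ {n} {X Y Z : Subset n} → X ⊆ Z → Y ⊆ Z → X ∪ Y ⊆ Z
∪-⊆ {X = X} {Y} X⊆Z Y⊆Z x∈X∪Y = [ X⊆Z , Y⊆Z ] (x∈p∪q⁻ X Y x∈X∪Y)

⊆⇒≡∪∩∁ : ∀ {n} {C X : Subset n} → C ⊆ X → X ≡ C ∪ (X ∩ ∁ C)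
⊆⇒≡∪∩∁ {C = C} {X} C⊆X = ⊆-antisym split (∪-⊆ C⊆X (p∩q⊆p X (∁ C)))
  where
  split : X ⊆ C ∪ (X ∩ ∁ C)
  split {x} x∈X with x ∈? C
  ... | yes x∈C = x∈p∪q⁺ (inj₁ x∈C)
  ... | no  x∉C = x∈p∪q⁺ (inj₂ (x∈p∩q⁺ (x∈X , x∉p⇒x∈∁p x∉C)))

disjoint⇒∉ : ∀ {n} {X Y : Subset n} {x} → Disjoint X Y → x ∈ X → x ∉ Y
disjoint⇒∉ X∩Y=∅ x∈X x∈Y = X∩Y=∅ (_ , x∈p∩q⁺ (x∈X , x∈Y))

∉⇒disjoint : ∀ {n} {X Y : Subset n} → (∀ {x} → x ∈ X → x ∉ Y) → Disjoint X Y
∉⇒disjoint {X = X} {Y} X∌Y (_ , x∈X∩Y) = let (x∈X , x∈Y) = x∈p∩q⁻ X Y x∈X∩Y in X∌Y x∈X x∈Y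

disjoint-sym : ∀ {n} {X Y : Subset n} → Disjoint X Y → Disjoint Y X
disjoint-sym X∩Y=∅ = ∉⇒disjoint λ x∈Y x∈X → disjoint⇒∉ X∩Y=∅ x∈X x∈Y

disjoint? : ∀ {n} (X Y : Subset n) → Dec (Disjoint X Y)
disjoint? X Y = ¬? (nonempty? (X ∩ Y))

∉⇒toℕ≡0 : ∀ {p n} (β : Fin n → Fin p) {X} → (∀ j → toℕ (β j) ≢ 0 → j ∈ X) →
          ∀ {j} → j ∉ X → toℕ (β j) ≡ 0
∉⇒toℕ≡0 β β⊆X {j} j∉X = decidable-stable (toℕ (β j) ℕ.≟ 0) (j∉X ∘ β⊆X j)

dependent⇒nonempty : ∀ {p m n} {B : Matrix p m n} {X} → Dependent B X → Nonempty X
dependent⇒nonempty (_ , _ , β⊆X , j , βj≢0) = j , β⊆X j βj≢0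

module Residues {p : ℕ} .{{_ : NonZero p}} where

  toℕ-mod : ∀ x → toℕ (x mod p) ≡ x % p
  toℕ-mod x = toℕ-fromℕ< (m%n<n x p)

  toℕ-0-mod : toℕ (0 mod p) ≡ 0
  toℕ-0-mod = trans (toℕ-mod 0) (m*n%n≡0 0 p)

  ∣toℕ⇒toℕ≡0 : (x : Fin p) → p ∣ toℕ x → toℕ x ≡ 0
  ∣toℕ⇒toℕ≡0 x p∣x = trans (sym (m<n⇒m%n≡m (toℕ<n x))) (n∣m⇒m%n≡0 _ p p∣x)

  toℕ≢0⇒∤ : (x : Fin p) → toℕ x ≢ 0 → ¬ p ∣ toℕ x
  toℕ≢0⇒∤ x x≢0 = x≢0 ∘ ∣toℕ⇒toℕ≡0 x

  prime⇒∤-* : Prime p → (x y : Fin p) → toℕ x ≢ 0 → toℕ y ≢ 0 → ¬ p ∣ toℕ x * toℕ y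
  prime⇒∤-* p-prime x y x≢0 y≢0 p∣xy =
    [ toℕ≢0⇒∤ x x≢0 , toℕ≢0⇒∤ y y≢0 ] (euclidsLemma (toℕ x) (toℕ y) p-prime p∣xy)

  ∣-mod-+ : ∀ x y → p ∣ x + y → p ∣ toℕ (x mod p) + toℕ (y mod p)
  ∣-mod-+ x y p∣x+y = m%n≡0⇒n∣m _ p (begin
    (toℕ (x mod p) + toℕ (y mod p)) % p  ≡⟨ cong₂ (λ u v → (u + v) % p) (toℕ-mod x) (toℕ-mod y) ⟩
    (x % p + y % p) % p                  ≡⟨ %-distribˡ-+ x y p ⟨
    (x + y) % p                          ≡⟨ n∣m⇒m%n≡0 _ p p∣x+y ⟩
    0                                    ∎)

  toℕ-mod-*-% : ∀ x y → (toℕ (x mod p) * y) % p ≡ (x * y) % p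
  toℕ-mod-*-% x y = begin
    (toℕ (x mod p) * y) % p      ≡⟨ cong (λ z → (z * y) % p) (toℕ-mod x) ⟩
    (x % p * y) % p              ≡⟨ %-distribˡ-* (x % p) y p ⟩
    (x % p % p * (y % p)) % p    ≡⟨ cong (λ z → (z * (y % p)) % p) (m%n%n≡m%n x p) ⟩
    (x % p * (y % p)) % p        ≡⟨ %-distribˡ-* x y p ⟨
    (x * y) % p                  ∎

module MatrixMatroid {p m n : ℕ} .{{_ : NonZero p}} (B : Matrix p m n) where

  open Residues

  NontrivialRelationIn : Subset n → (Fin n → Fin p) → Set
  NontrivialRelationIn X β =
    IsRelation B β × (∀ j → toℕ (β j) ≢ 0 → j ∈ X) × (∃ λ j → toℕ (β j) ≢ 0)

  nontrivialRelationIn? : ∀ X β → Dec (NontrivialRelationIn X β)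
  nontrivialRelationIn? X β =
    all? (λ i → p ∣? Σℕ (λ j → toℕ (β j) * toℕ (B i j)))
    ×-dec all? (λ j → ¬? (toℕ (β j) ℕ.≟ 0) →-dec j ∈? X)
    ×-dec any? (λ j → ¬? (toℕ (β j) ℕ.≟ 0))

  nontrivialRelationIn-resp : ∀ X {β γ} → β ≗ γ → NontrivialRelationIn X β → NontrivialRelationIn X γ
  nontrivialRelationIn-resp X β≗γ (relation , β⊆X , j , βj≢0) =
      (λ i → subst (p ∣_) (Σℕ-cong λ k → cong (λ x → toℕ x * toℕ (B i k)) (β≗γ k)) (relation i))
    , (λ k γk≢0 → β⊆X k (γk≢0 ∘ subst (λ x → toℕ x ≡ 0) (β≗γ k)))
    , j , βj≢0 ∘ subst (λ x → toℕ x ≡ 0) (sym (β≗γ j))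

  dependent? : ∀ X → Dec (Dependent B X)
  dependent? X = anyFunction? (nontrivialRelationIn-resp X) (nontrivialRelationIn? X)

  dependentProperSubset? : ∀ X → Dec (∃ λ D → D ⊂ X × Dependent B D)
  dependentProperSubset? X = anySubset? λ D → D ⊂? X ×-dec dependent? D

  circuit? : ∀ X → Dec (Circuit B X)
  circuit? X with dependent? X | dependentProperSubset? X
  ... | no  ¬dependent | _                  = no (¬dependent ∘ proj₁)
  ... | yes dependent  | yes (D , D⊂X , dD) = no λ (_ , minimal) → minimal D D⊂X dD
  ... | yes dependent  | no  ¬smaller       = yes (dependent , λ D D⊂X dD → ¬smaller (D , D⊂X , dD))

  circuit-within : ∀ X → Dependent B X → ∃ λ C → C ⊆ X × Circuit B C
  circuit-within X = go X (⊂-wellFounded X)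
    where
    go : ∀ X → Acc _⊂_ X → Dependent B X → ∃ λ C → C ⊆ X × Circuit B C
    go X (acc smaller) dX with dependentProperSubset? X
    ... | yes (D , D⊂X , dD) = let (C , C⊆D , circuitC) = go D (smaller D⊂X) dD
                               in C , ⊆-trans C⊆D (p⊂q⇒p⊆q D⊂X) , circuitC
    ... | no ¬smaller = X , ⊆-refl , dX , λ D D⊂X dD → ¬smaller (D , D⊂X , dD)

  circuit-if-no-smaller-circuit : ∀ {X} → Dependent B X → (∀ D → D ⊂ X → ¬ Circuit B D) → Circuit B X
  circuit-if-no-smaller-circuit dX noSmaller = dX , λ D D⊂X dD →
    let (C , C⊆D , circuitC) = circuit-within D dD in noSmaller C (⊆-⊂-trans C⊆D D⊂X) circuitC

  -- A coefficient vanishing on j would give a relation supported in C - j.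
  circuit-support : ∀ {C c} → Circuit B C → NontrivialRelationIn C c → SupportIs c C
  circuit-support {C} {c} (_ , minimal) (relation , c⊆C , c≢0) j = c⊆C j , λ j∈C cj≡0 →
    minimal (C - j) (x∈p⇒p-x⊂p j∈C)
      (c , relation
         , (λ k ck≢0 → x∈p∧x≢y⇒x∈p-y (c⊆C k ck≢0)
                          λ k≡j → ck≢0 (subst (λ x → toℕ (c x) ≡ 0) (sym k≡j) cj≡0))
         , c≢0)

  circuit-relation : ∀ {C} → Circuit B C → ∃ λ c → IsRelation B c × SupportIs c C
  circuit-relation circuitC@((c , relation , c⊆C , c≢0) , _) =
    c , relation , circuit-support circuitC (relation , c⊆C , c≢0)

  isRelation-mod : (u : Fin n → ℕ) → (∀ i → p ∣ Σℕ (λ j → u j * toℕ (B i j))) →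
                   IsRelation B (λ j → u j mod p)
  isRelation-mod u p∣ i = m%n≡0⇒n∣m _ p
    (trans (Σℕ-%-cong p λ j → toℕ-mod-*-% (u j) (toℕ (B i j))) (n∣m⇒m%n≡0 _ p (p∣ i)))

  isRelation-linear : ∀ c d → IsRelation B c → IsRelation B d → ∀ k l →
                      IsRelation B (λ j → (k * toℕ (c j) + l * toℕ (d j)) mod p)
  isRelation-linear c d c-relation d-relation k l = isRelation-mod _ λ i →
    subst (p ∣_) (sym (expand i)) (∣m∣n⇒∣m+n (∣n⇒∣m*n k (c-relation i)) (∣n⇒∣m*n l (d-relation i)))
    where
    expand : ∀ i → Σℕ (λ j → (k * toℕ (c j) + l * toℕ (d j)) * toℕ (B i j))
                 ≡ k * Σℕ (λ j → toℕ (c j) * toℕ (B i j)) + l * Σℕ (λ j → toℕ (d j) * toℕ (B i j))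
    expand i = begin
      Σℕ (λ j → (k * toℕ (c j) + l * toℕ (d j)) * toℕ (B i j))
        ≡⟨ Σℕ-cong (λ j → trans (*-distribʳ-+ (toℕ (B i j)) (k * toℕ (c j)) (l * toℕ (d j)))
                                (cong₂ _+_ (*-assoc k _ _) (*-assoc l _ _))) ⟩
      Σℕ (λ j → k * cB j + l * dB j)       ≡⟨ Σℕ-+ (λ j → k * cB j) (λ j → l * dB j) ⟩
      Σℕ (λ j → k * cB j) + Σℕ (λ j → l * dB j)  ≡⟨ cong₂ _+_ (Σℕ-*ˡ k cB) (Σℕ-*ˡ l dB) ⟩
      k * Σℕ cB + l * Σℕ dB                 ∎
      where
      cB dB : Fin n → ℕ
      cB j = toℕ (c j) * toℕ (B i j)
      dB j = toℕ (d j) * toℕ (B i j)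

module SplitMatroid {p : ℕ} .{{_ : NonZero p}} (p-prime : Prime p)
                    {m n : ℕ} (A : Matrix p m n) (a b : Fin n) (a≢b : a ≢ b)
                    (α : Fin p) (α≢0 : toℕ α ≢ 0) where

  open Residues
  open Splitting A a b
  module M  = MatrixMatroid A
  module M′ = MatrixMatroid (splitMatrix A a b α)

  A′ : Matrix p (suc m) n
  A′ = splitMatrix A a b α

  RowRelation : (Fin n → Fin p) → (Fin n → Fin p) → Set
  RowRelation β row = p ∣ Σℕ (λ j → toℕ (β j) * toℕ (row j))

  splitRow-a : splitRow a b α a ≡ α
  splitRow-a with a ≟ a
  ... | yes _   = refl
  ... | no  a≢a = ⊥-elim (a≢a refl)

  splitRow-b : splitRow a b α b ≡ α
  splitRow-b with b ≟ a | b ≟ b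
  ... | yes _   | _       = refl
  ... | no  _   | yes _   = refl
  ... | no  _   | no  b≢b = ⊥-elim (b≢b refl)

  splitRow-elsewhere : ∀ {j} → j ≢ a → j ≢ b → toℕ (splitRow a b α j) ≡ 0
  splitRow-elsewhere {j} j≢a j≢b with j ≟ a | j ≟ b
  ... | yes j≡a | _       = ⊥-elim (j≢a j≡a)
  ... | no  _   | yes j≡b = ⊥-elim (j≢b j≡b)
  ... | no  _   | no  _   = toℕ-0-mod

  Σℕ-splitRow : ∀ (β : Fin n → Fin p) → Σℕ (λ j → toℕ (β j) * toℕ (splitRow a b α j)) ≡ (toℕ (β a) + toℕ (β b)) * toℕ α
  Σℕ-splitRow β = begin
    Σℕ (λ j → toℕ (β j) * toℕ (splitRow a b α j))
      ≡⟨ Σℕ-pair (λ j → toℕ (β j) * toℕ (splitRow a b α j)) a≢b (λ j j≢a j≢b → trans (cong (toℕ (β j) *_) (splitRow-elsewhere j≢a j≢b))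
                                            (*-zeroʳ (toℕ (β j)))) ⟩
    toℕ (β a) * toℕ (splitRow a b α a) + toℕ (β b) * toℕ (splitRow a b α b)
      ≡⟨ cong₂ (λ x y → toℕ (β a) * toℕ x + toℕ (β b) * toℕ y) splitRow-a splitRow-b ⟩
    toℕ (β a) * toℕ α + toℕ (β b) * toℕ α
      ≡⟨ *-distribʳ-+ (toℕ α) (toℕ (β a)) (toℕ (β b)) ⟨
    (toℕ (β a) + toℕ (β b)) * toℕ α
      ∎

  splitRow-relation⇔ : ∀ (β : Fin n → Fin p) → RowRelation β (splitRow a b α) ⇔ p ∣ toℕ (β a) + toℕ (β b)
  splitRow-relation⇔ β = mk⇔
    (λ p∣Σ → [ id , (λ p∣α → ⊥-elim (toℕ≢0⇒∤ α α≢0 p∣α)) ]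
               (euclidsLemma (toℕ (β a) + toℕ (β b)) (toℕ α) p-prime (subst (p ∣_) (Σℕ-splitRow β) p∣Σ)))
    (λ p∣βa+βb → subst (p ∣_) (sym (Σℕ-splitRow β)) (∣m⇒∣m*n (toℕ α) p∣βa+βb))

  split-relation⁻ : ∀ β → IsRelation A′ β → IsRelation A β × p ∣ toℕ (β a) + toℕ (β b)
  split-relation⁻ β relation′ =
    let (relation , last) = ∀-appendRow⁻ {P = RowRelation β} m A (splitRow a b α) relation′
    in relation , Equivalence.to (splitRow-relation⇔ β) last

  split-relation⁺ : ∀ β → IsRelation A β → p ∣ toℕ (β a) + toℕ (β b) → IsRelation A′ β
  split-relation⁺ β relation p∣βa+βb =
    ∀-appendRow⁺ {P = RowRelation β} m A (splitRow a b α)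
      (relation , Equivalence.from (splitRow-relation⇔ β) p∣βa+βb)

  split-dependent⇒dependent : ∀ {X} → Dependent A′ X → Dependent A X
  split-dependent⇒dependent (β , relation′ , β⊆X , β≢0) = β , proj₁ (split-relation⁻ β relation′) , β⊆X , β≢0

  relation-through-a⇒split-dependent : ∀ {X β} → IsRelation A β → SupportIs β X →
    p ∣ toℕ (β a) + toℕ (β b) → a ∈ X → Dependent A′ X
  relation-through-a⇒split-dependent {β = β} relation support p∣βa+βb a∈X =
    β , split-relation⁺ β relation p∣βa+βb , proj₁ ∘ support , a , proj₂ (support a) a∈X

  C₀⇒split-dependent : ∀ {X} → InC0 X → Dependent A′ X
  C₀⇒split-dependent (_ , inj₁ (_ , a∈X , _ , c , relation , support , p∣ca+cb)) =
    relation-through-a⇒split-dependent relation support p∣ca+cb a∈X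
  C₀⇒split-dependent (((β , relation , β⊆X , β≢0) , _) , inj₂ (a∉X , b∉X)) =
    β , split-relation⁺ β relation p∣βa+βb , β⊆X , β≢0
    where
    p∣βa+βb : p ∣ toℕ (β a) + toℕ (β b)
    p∣βa+βb = subst (p ∣_) (sym (cong₂ _+_ (∉⇒toℕ≡0 β β⊆X a∉X) (∉⇒toℕ≡0 β β⊆X b∉X))) (p ∣0)

  pDependent⇒split-dependent : ∀ {X} → PDependent X → Dependent A′ X
  pDependent⇒split-dependent (_ , a∈X , _ , _ , β , relation , support , p∣βa+βb) =
    relation-through-a⇒split-dependent relation support p∣βa+βb a∈X

  -- With relations c of C₁ and d of C₂, the combination d_b·c + (p - c_a)·d takes the
  -- values d_b·c_a at a and (p - c_a)·d_b at b, whose sum is a multiple of p.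
  disjoint-circuits⇒split-dependent : ∀ {C₁ C₂} → Circuit A C₁ → Circuit A C₂ →
    a ∈ C₁ → b ∈ C₂ → Disjoint C₁ C₂ → Dependent A′ (C₁ ∪ C₂)
  disjoint-circuits⇒split-dependent {C₁} {C₂} circuit₁ circuit₂ a∈C₁ b∈C₂ C₁∩C₂=∅
    with M.circuit-relation circuit₁ | M.circuit-relation circuit₂
  ... | c , c-relation , c-support | d , d-relation , d-support =
    β , split-relation⁺ β (M.isRelation-linear c d c-relation d-relation k l) (∣-mod-+ (u a) (u b) p∣ua+ub)
      , β⊆C₁∪C₂ , a , βa≢0
    where
    k l : ℕ
    k = toℕ (d b)
    l = p ∸ toℕ (c a)
    u : Fin n → ℕ
    u j = k * toℕ (c j) + l * toℕ (d j)
    β : Fin n → Fin p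
    β j = u j mod p

    u≡0 : ∀ {j} → toℕ (c j) ≡ 0 → toℕ (d j) ≡ 0 → u j ≡ 0
    u≡0 cj≡0 dj≡0 = trans (cong₂ (λ x y → k * x + l * y) cj≡0 dj≡0) (cong₂ _+_ (*-zeroʳ k) (*-zeroʳ l))

    ua≡ : u a ≡ k * toℕ (c a)
    ua≡ = trans (cong (λ x → k * toℕ (c a) + l * x) (∉⇒toℕ≡0 d (proj₁ ∘ d-support) (disjoint⇒∉ C₁∩C₂=∅ a∈C₁)))
                (trans (cong (k * toℕ (c a) +_) (*-zeroʳ l)) (+-identityʳ _))

    ub≡ : u b ≡ l * k
    ub≡ = trans (cong (λ x → k * x + l * k)
                      (∉⇒toℕ≡0 c (proj₁ ∘ c-support) (disjoint⇒∉ (disjoint-sym C₁∩C₂=∅) b∈C₂)))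
                (cong (_+ l * k) (*-zeroʳ k))

    p∣ua+ub : p ∣ u a + u b
    p∣ua+ub = subst (p ∣_) (sym (begin
      u a + u b                 ≡⟨ cong₂ _+_ ua≡ ub≡ ⟩
      k * toℕ (c a) + l * k     ≡⟨ cong (k * toℕ (c a) +_) (*-comm l k) ⟩
      k * toℕ (c a) + k * l     ≡⟨ *-distribˡ-+ k (toℕ (c a)) l ⟨
      k * (toℕ (c a) + l)       ≡⟨ cong (k *_) (m+[n∸m]≡n (<⇒≤ (toℕ<n (c a)))) ⟩
      k * p                     ∎)) (n∣m*n k)

    βa≢0 : toℕ (β a) ≢ 0
    βa≢0 βa≡0 = prime⇒∤-* p-prime (d b) (c a) (proj₂ (d-support b) b∈C₂) (proj₂ (c-support a) a∈C₁)
      (subst (p ∣_) ua≡ (m%n≡0⇒n∣m (u a) p (trans (sym (toℕ-mod (u a))) βa≡0)))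

    β⊆C₁∪C₂ : ∀ j → toℕ (β j) ≢ 0 → j ∈ C₁ ∪ C₂
    β⊆C₁∪C₂ j βj≢0 with j ∈? C₁ | j ∈? C₂
    ... | yes j∈C₁ | _        = x∈p∪q⁺ (inj₁ j∈C₁)
    ... | no  _    | yes j∈C₂ = x∈p∪q⁺ (inj₂ j∈C₂)
    ... | no  j∉C₁ | no  j∉C₂ = ⊥-elim (βj≢0 (trans (cong (λ x → toℕ (x mod p))
            (u≡0 (∉⇒toℕ≡0 c (proj₁ ∘ c-support) j∉C₁) (∉⇒toℕ≡0 d (proj₁ ∘ d-support) j∉C₂))) toℕ-0-mod))

  family₂⇒split-dependent : ∀ {X} → Family2 X → Dependent A′ X
  family₂⇒split-dependent ((C₁ , C₂ , circuit₁ , circuit₂ , a∈C₁ , b∈C₂ , C₁∩C₂=∅ , X≡C₁∪C₂) , _) =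
    subst (Dependent A′) (sym X≡C₁∪C₂) (disjoint-circuits⇒split-dependent circuit₁ circuit₂ a∈C₁ b∈C₂ C₁∩C₂=∅)

  CircuitPairIn : Subset n → Set
  CircuitPairIn X = Σ (Subset n) λ C₁ → Σ (Subset n) λ C₂ →
    Circuit A C₁ × Circuit A C₂ × a ∈ C₁ × b ∈ C₂ × Disjoint C₁ C₂ × C₁ ⊆ X × C₂ ⊆ X

  circuitPairIn? : ∀ X → Dec (CircuitPairIn X)
  circuitPairIn? X = anySubset? λ C₁ → anySubset? λ C₂ →
    M.circuit? C₁ ×-dec M.circuit? C₂ ×-dec a ∈? C₁ ×-dec b ∈? C₂
    ×-dec disjoint? C₁ C₂ ×-dec C₁ ⊆? X ×-dec C₂ ⊆? X

  npCircuit⇒a∈⊎b∈ : ∀ {C} → NPCircuit C → a ∈ C ⊎ b ∈ C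
  npCircuit⇒a∈⊎b∈ (_ , inj₁ (inj₁ (a∈C , _))) = inj₁ a∈C
  npCircuit⇒a∈⊎b∈ (_ , inj₁ (inj₂ (_ , b∈C))) = inj₂ b∈C
  npCircuit⇒a∈⊎b∈ (_ , inj₂ (a∈C , _))        = inj₁ a∈C

  disjoint-npCircuits⇒circuitPairIn : ∀ {X D₁ D₂} → NPCircuit D₁ → NPCircuit D₂ → Disjoint D₁ D₂ →
    D₁ ⊆ X → D₂ ⊆ X → CircuitPairIn X
  disjoint-npCircuits⇒circuitPairIn {D₁ = D₁} {D₂} np₁ np₂ D₁∩D₂=∅ D₁⊆X D₂⊆X
    with npCircuit⇒a∈⊎b∈ np₁ | npCircuit⇒a∈⊎b∈ np₂
  ... | inj₁ a∈D₁ | inj₁ a∈D₂ = ⊥-elim (disjoint⇒∉ D₁∩D₂=∅ a∈D₁ a∈D₂)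
  ... | inj₁ a∈D₁ | inj₂ b∈D₂ =
    D₁ , D₂ , proj₁ np₁ , proj₁ np₂ , a∈D₁ , b∈D₂ , D₁∩D₂=∅ , D₁⊆X , D₂⊆X
  ... | inj₂ b∈D₁ | inj₁ a∈D₂ =
    D₂ , D₁ , proj₁ np₂ , proj₁ np₁ , a∈D₂ , b∈D₁ , disjoint-sym D₁∩D₂=∅ , D₂⊆X , D₁⊆X
  ... | inj₂ b∈D₁ | inj₂ b∈D₂ = ⊥-elim (disjoint⇒∉ D₁∩D₂=∅ b∈D₁ b∈D₂)

  module SplitCircuit {X : Subset n} (circuitX : Circuit A′ X) where

    minimal : ∀ D → D ⊂ X → Independent A′ D
    minimal = proj₂ circuitX

    β : Fin n → Fin p
    β = proj₁ (proj₁ circuitX)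

    nontrivial : M′.NontrivialRelationIn X β
    nontrivial = proj₂ (proj₁ circuitX)

    relation : IsRelation A β
    relation = proj₁ (split-relation⁻ β (proj₁ nontrivial))

    p∣βa+βb : p ∣ toℕ (β a) + toℕ (β b)
    p∣βa+βb = proj₂ (split-relation⁻ β (proj₁ nontrivial))

    support : SupportIs β X
    support = M′.circuit-support circuitX nontrivial

    dependent : Dependent A X
    dependent = split-dependent⇒dependent (proj₁ circuitX)

    a∈⇒b∈ : a ∈ X → b ∈ X
    a∈⇒b∈ a∈X = decidable-stable (b ∈? X) λ b∉X → toℕ≢0⇒∤ (β a) (proj₂ (support a) a∈X)
      (subst (p ∣_) (trans (cong (toℕ (β a) +_) (∉⇒toℕ≡0 β (proj₁ ∘ support) b∉X)) (+-identityʳ _)) p∣βa+βb)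

    b∈⇒a∈ : b ∈ X → a ∈ X
    b∈⇒a∈ b∈X = decidable-stable (a ∈? X) λ a∉X → toℕ≢0⇒∤ (β b) (proj₂ (support b) b∈X)
      (subst (p ∣_) (cong (_+ toℕ (β b)) (∉⇒toℕ≡0 β (proj₁ ∘ support) a∉X)) p∣βa+βb)

    proper⇒¬C₀ : ∀ D → D ⊂ X → ¬ InC0 D
    proper⇒¬C₀ D D⊂X = minimal D D⊂X ∘ C₀⇒split-dependent

    proper-circuit⇒np : ∀ {D} → D ⊂ X → Circuit A D → NPCircuit D
    proper-circuit⇒np {D} D⊂X circuitD with a ∈? D | b ∈? D
    ... | no  a∉D | no  b∉D = ⊥-elim (proper⇒¬C₀ D D⊂X (circuitD , inj₂ (a∉D , b∉D)))
    ... | yes a∈D | no  b∉D = circuitD , inj₁ (inj₁ (a∈D , b∉D))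
    ... | no  a∉D | yes b∈D = circuitD , inj₁ (inj₂ (a∉D , b∈D))
    ... | yes a∈D | yes b∈D with M.circuit-relation circuitD
    ...   | c , c-relation , c-support with p ∣? toℕ (c a) + toℕ (c b)
    ...     | yes p∣ = ⊥-elim (proper⇒¬C₀ D D⊂X
                          (circuitD , inj₁ (circuitD , a∈D , b∈D , c , c-relation , c-support , p∣)))
    ...     | no  p∤ = circuitD , inj₂ (a∈D , b∈D , c , c-relation , c-support , p∤)

    circuit⇒C₀ : Circuit A X → InC0 X
    circuit⇒C₀ circuitAX with a ∈? X
    ... | yes a∈X = circuitAX , inj₁ (circuitAX , a∈X , a∈⇒b∈ a∈X , β , relation , support , p∣βa+βb)
    ... | no  a∉X = circuitAX , inj₂ (a∉X , a∉X ∘ b∈⇒a∈)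

    circuitPairIn⇒C₂ : CircuitPairIn X → InC2 X
    circuitPairIn⇒C₂ (C₁ , C₂ , circuit₁ , circuit₂ , a∈C₁ , b∈C₂ , C₁∩C₂=∅ , C₁⊆X , C₂⊆X)
      with ⊆⇒≡⊎⊂ (∪-⊆ C₁⊆X C₂⊆X)
    ... | inj₂ C₁∪C₂⊂X = ⊥-elim (minimal _ C₁∪C₂⊂X
                            (disjoint-circuits⇒split-dependent circuit₁ circuit₂ a∈C₁ b∈C₂ C₁∩C₂=∅))
    ... | inj₁ C₁∪C₂≡X =
      ((C₁ , C₂ , circuit₁ , circuit₂ , a∈C₁ , b∈C₂ , C₁∩C₂=∅ , sym C₁∪C₂≡X) , noSmaller)
      , λ T family₂ T⊂X → minimal T T⊂X (family₂⇒split-dependent family₂)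
      where
      noSmaller : ¬ (Σ (Subset n) λ C → (InC0 C ⊎ InC1 C) × C ⊂ X)
      noSmaller (D , inj₁ c₀ , D⊂X) = proper⇒¬C₀ D D⊂X c₀
      noSmaller (D , inj₂ c₁ , D⊂X) = minimal D D⊂X (pDependent⇒split-dependent (proj₁ (proj₁ c₁)))

    proper-circuit⇒C₁ : ∀ {C} → C ⊂ X → Circuit A C → ¬ CircuitPairIn X → InC1 X
    proper-circuit⇒C₁ {C} C⊂X circuitC ¬pair =
      ( ( ( (C , X ∩ ∁ C , npC , rest-independent , ∉⇒disjoint (λ x∈C → x∉rest x∈C) , ⊆⇒≡∪∩∁ C⊆X)
          , a∈X , a∈⇒b∈ a∈X , no-C₀ , β , relation , support , p∣βa+βb)
        , λ (D₁ , D₂ , np₁ , np₂ , D₁∩D₂=∅ , D₁∪D₂⊆X) → ¬pair (disjoint-npCircuits⇒circuitPairIn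
                np₁ np₂ D₁∩D₂=∅ (⊆-trans (p⊆p∪q D₂) D₁∪D₂⊆X) (⊆-trans (q⊆p∪q D₁ D₂) D₁∪D₂⊆X)))
      , λ T family₁ T⊂X → minimal T T⊂X (pDependent⇒split-dependent (proj₁ family₁)))
      where
      C⊆X = p⊂q⇒p⊆q C⊂X
      npC = proper-circuit⇒np C⊂X circuitC

      x∉rest : ∀ {x} → x ∈ C → x ∉ X ∩ ∁ C
      x∉rest x∈C x∈rest = x∈∁p⇒x∉p (p∩q⊆q X (∁ C) x∈rest) x∈C

      rest-independent : Independent A (X ∩ ∁ C)
      rest-independent dependentRest with M.circuit-within _ dependentRest
      ... | C′ , C′⊆rest , circuitC′ = ¬pair (disjoint-npCircuits⇒circuitPairIn
              npC (proper-circuit⇒np C′⊂X circuitC′) C∩C′=∅ C⊆X C′⊆X)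
        where
        C′⊆X : C′ ⊆ X
        C′⊆X = ⊆-trans C′⊆rest (p∩q⊆p X (∁ C))

        C∩C′=∅ : Disjoint C C′
        C∩C′=∅ = ∉⇒disjoint λ x∈C x∈C′ → x∉rest x∈C (C′⊆rest x∈C′)

        C′⊂X : C′ ⊂ X
        C′⊂X = let (j , j∈C) = dependent⇒nonempty (proj₁ circuitC)
               in C′⊆X , j , C⊆X j∈C , disjoint⇒∉ C∩C′=∅ j∈C

      a∈X : a ∈ X
      a∈X = [ C⊆X , b∈⇒a∈ ∘ C⊆X ] (npCircuit⇒a∈⊎b∈ npC)

      no-C₀ : ∀ D → D ⊆ X → ¬ InC0 D
      no-C₀ D D⊆X c₀ with ⊆⇒≡⊎⊂ D⊆X
      ... | inj₁ D≡X = proj₂ (subst (Circuit A) D≡X (proj₁ c₀)) C C⊂X (proj₁ circuitC)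
      ... | inj₂ D⊂X = proper⇒¬C₀ D D⊂X c₀

    classify : InC0 X ⊎ InC1 X ⊎ InC2 X
    classify with M.circuit-within X dependent
    ... | C , C⊆X , circuitC with ⊆⇒≡⊎⊂ C⊆X
    ...   | inj₁ C≡X = inj₁ (circuit⇒C₀ (subst (Circuit A) C≡X circuitC))
    ...   | inj₂ C⊂X with circuitPairIn? X
    ...     | yes pair = inj₂ (inj₂ (circuitPairIn⇒C₂ pair))
    ...     | no ¬pair = inj₂ (inj₁ (proper-circuit⇒C₁ C⊂X circuitC ¬pair))

  split-circuit⇒C₀⊎C₁⊎C₂ : ∀ {X} → Circuit A′ X → InC0 X ⊎ InC1 X ⊎ InC2 X
  split-circuit⇒C₀⊎C₁⊎C₂ circuitX = SplitCircuit.classify circuitX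

  C₀⊎C₁⊎C₂⇒split-circuit : ∀ {X} → InC0 X ⊎ InC1 X ⊎ InC2 X → Circuit A′ X
  C₀⊎C₁⊎C₂⇒split-circuit (inj₁ c₀@(circuitX , _)) =
    M′.circuit-if-no-smaller-circuit (C₀⇒split-dependent c₀) λ D D⊂X circuitD →
      proj₂ circuitX D D⊂X (split-dependent⇒dependent (proj₁ circuitD))
  C₀⊎C₁⊎C₂⇒split-circuit {X} (inj₂ (inj₁ ((pDependent@(_ , _ , _ , no-C₀ , _) , ¬npPair) , minimal))) =
    M′.circuit-if-no-smaller-circuit (pDependent⇒split-dependent pDependent) noSmaller
    where
    noSmaller : ∀ D → D ⊂ X → ¬ Circuit A′ D
    noSmaller D D⊂X circuitD with split-circuit⇒C₀⊎C₁⊎C₂ circuitD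
    ... | inj₁ c₀         = no-C₀ D (p⊂q⇒p⊆q D⊂X) c₀
    ... | inj₂ (inj₁ c₁)  = minimal D (proj₁ c₁) D⊂X
    ... | inj₂ (inj₂ (((C₁ , C₂ , circuit₁ , circuit₂ , a∈C₁ , b∈C₂ , C₁∩C₂=∅ , D≡C₁∪C₂) , _) , _)) =
      ¬npPair ( C₁ , C₂
              , (circuit₁ , inj₁ (inj₁ (a∈C₁ , disjoint⇒∉ (disjoint-sym C₁∩C₂=∅) b∈C₂)))
              , (circuit₂ , inj₁ (inj₂ (disjoint⇒∉ C₁∩C₂=∅ a∈C₁ , b∈C₂)))
              , C₁∩C₂=∅ , subst (_⊆ X) D≡C₁∪C₂ (p⊂q⇒p⊆q D⊂X))
  C₀⊎C₁⊎C₂⇒split-circuit {X} (inj₂ (inj₂ ((family₂@(_ , noSmallerMember) , minimal)))) =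
    M′.circuit-if-no-smaller-circuit (family₂⇒split-dependent family₂) noSmaller
    where
    noSmaller : ∀ D → D ⊂ X → ¬ Circuit A′ D
    noSmaller D D⊂X circuitD with split-circuit⇒C₀⊎C₁⊎C₂ circuitD
    ... | inj₁ c₀         = noSmallerMember (D , inj₁ c₀ , D⊂X)
    ... | inj₂ (inj₁ c₁)  = noSmallerMember (D , inj₂ c₁ , D⊂X)
    ... | inj₂ (inj₂ c₂)  = minimal D (proj₁ c₂) D⊂X

mainTheorem3 : (p : ℕ) → .{{_ : NonZero p}} → Prime p
    → (m n : ℕ) (A : Matrix p m n) (a b : Fin n) → a ≢ b
    → (α : Fin p) → toℕ α ≢ 0
    → (X : Subset n)
    → Circuit (splitMatrix A a b α) X
    ⇔ (Splitting.InC0 A a b X ⊎ Splitting.InC1 A a b X ⊎ Splitting.InC2 A a b X)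
mainTheorem3 p p-prime m n A a b a≢b α α≢0 X =
  mk⇔ split-circuit⇒C₀⊎C₁⊎C₂ C₀⊎C₁⊎C₂⇒split-circuit
  where open SplitMatroid p-prime A a b a≢b α α≢0
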